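{- Let $G=(V,E)$ be a finite simple graph of diameter at most $2$, with vertex set $V=\{v_1,\ldots,v_n\}$ and edge set $E=\{e_1,\ldots,e_m\}$. Let $S$ be the following system of polynomial equations in $\mathbb{F}_2[x_1,\ldots,x_m]$: for every pair $i<j$ with $(v_i,v_j)\notin E$, $$\prod_{e_a,e_b\in E:\ v_i-e_a-e_b-v_j\text{ is a path in }G}\left(x_a+x_b+1\right)=0 .$$ (If every pair of distinct vertices is adjacent, $S$ is the trivial system $0=0$.) Then $rc(G)\le 2$ if and only if $S$ has a solution in $\mathbb{F}_2^m$.
   Context: A path $v_i-e_a-e_b-v_j$ means that $e_a=(v_i,w)$ and $e_b=(w,v_j)$ are edges of $G$ for some vertex $w$. In an edge-colored graph, a rainbow path is a path whose edges all have distinct colors; $G$ is rainbow connected if every two vertices are joined by a rainbow path. The rainbow connection number $rc(G)$ is the least number of colors in an edge coloring of $G$ making $G$ rainbow connected. -}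

module Defs where

open import Data.Nat using (ℕ; _≤_)
open import Data.Fin using (Fin; _<_) renaming (_≟_ to _≟F_)
open import Data.Fin.Properties using (any?)
open import Data.Bool using (Bool; true; false; _xor_; _∧_)
open import Data.Product using (Σ; ∃; ∃-syntax; _×_; _,_; proj₁; proj₂)
open import Data.Product.Properties using (≡-dec)
open import Data.Sum using (_⊎_)
open import Data.List using (List; []; _∷_; map; foldr; filter; cartesianProduct; allFin)
open import Data.List.Relation.Unary.Unique.Propositional using (Unique)
open import Relation.Nullary using (¬_; Dec)
open import Relation.Nullary.Decidable using (_⊎-dec_; _×-dec_)
open import Relation.Binary.PropositionalEquality using (_≡_; _≢_)

-- A finite simple graph with vertices v_1..v_n (Fin n) and an enumerated
-- edge set e_1..e_m (Fin m); edge a has endpoints  ends a.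
record SimpleGraph : Set where
  field
    n : ℕ
    m : ℕ
    ends : Fin m → Fin n × Fin n
    noLoop : ∀ a → proj₁ (ends a) ≢ proj₂ (ends a)
    noMulti : ∀ a b → a ≢ b →
      (ends a ≢ ends b) × (ends a ≢ (proj₂ (ends b) , proj₁ (ends b)))

module _ (G : SimpleGraph) where
  open SimpleGraph G

  Joins : Fin m → Fin n → Fin n → Set
  Joins a u w = (ends a ≡ (u , w)) ⊎ (ends a ≡ (w , u))

  Adjacent : Fin n → Fin n → Set
  Adjacent u v = ∃[ a ] Joins a u v

  DiameterAtMost2 : Set
  DiameterAtMost2 = ∀ u v → (u ≡ v) ⊎ Adjacent u v ⊎ (∃[ w ] (Adjacent u w × Adjacent w v))

  data Walk : Fin n → Fin n → List (Fin n) → List (Fin m) → Set where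
    here : ∀ {u} → Walk u u (u ∷ []) []
    step : ∀ {u w v vs es} (a : Fin m) → Joins a u w → Walk w v vs es →
           Walk u v (u ∷ vs) (a ∷ es)

  Path : Fin n → Fin n → List (Fin n) → List (Fin m) → Set
  Path u v vs es = Walk u v vs es × Unique vs

  RainbowConnected : (k : ℕ) → (Fin m → Fin k) → Set
  RainbowConnected k c = ∀ u v → ∃[ vs ] ∃[ es ] (Path u v vs es × Unique (map c es))

  RcAtMost2 : Set
  RcAtMost2 = ∃[ k ] (k ≤ 2 × Σ (Fin m → Fin k) (RainbowConnected k))

  joins? : ∀ a u w → Dec (Joins a u w)
  joins? a u w = ≡-dec _≟F_ _≟F_ (ends a) (u , w) ⊎-dec ≡-dec _≟F_ _≟F_ (ends a) (w , u)

  -- v_i - e_a - e_b - v_j is a path: e_a = (v_i,w), e_b = (w,v_j) for some w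
  TwoPath : Fin n → Fin n → Fin m × Fin m → Set
  TwoPath i j (a , b) = ∃[ w ] (Joins a i w × Joins b w j)

  twoPath? : ∀ i j p → Dec (TwoPath i j p)
  twoPath? i j (a , b) = any? (λ w → joins? a i w ×-dec joins? b w j)

  twoPaths : Fin n → Fin n → List (Fin m × Fin m)
  twoPaths i j = filter (twoPath? i j) (cartesianProduct (allFin m) (allFin m))

  -- F_2 = Bool with + = xor, * = ∧, 0 = false, 1 = true.
  -- Evaluation at x ∈ F_2^m of the polynomial  ∏_{(a,b)} (x_a + x_b + 1)
  evalS : (Fin m → Bool) → Fin n → Fin n → Bool
  evalS x i j = foldr (λ p acc → ((x (proj₁ p) xor x (proj₂ p)) xor true) ∧ acc) true (twoPaths i j)

  SolvesS : (Fin m → Bool) → Set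
  SolvesS x = ∀ (i j : Fin n) → i < j → ¬ Adjacent i j → evalS x i j ≡ false

  SHasSolution : Set
  SHasSolution = ∃[ x ] SolvesS x

module Submission where

-- With at most two colours a rainbow path has at most two edges, so
-- between two distinct non-adjacent vertices it is a 2-path  i - e_a - e_b - j
-- whose two edges get different colours.  Identifying the (at most) two colours
-- with the elements of F₂, "e_a and e_b have different colours" is exactly
-- x_a + x_b + 1 = 0, and a product over F₂ vanishes iff one of its factors does.
-- Hence a rainbow 2-colouring gives a solution of S and, conversely, a solution
-- x of S gives the 2-colouring  a ↦ x_a  in which every non-adjacent pair is
-- joined by a rainbow 2-path (and adjacent pairs by a single edge).

open import Defs
open import Function.Bundles using (_⇔_; mk⇔)
open import Data.Nat using (z≤n; s≤s) renaming (_≤_ to _≤ℕ_)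
open import Data.Fin using (Fin; zero; suc; _<_)
open import Data.Fin.Properties using (<-cmp; <⇒≢; any?)
open import Data.Bool using (Bool; true; false; _xor_; _∧_)
open import Data.Product using (∃-syntax; _×_; _,_; proj₁; proj₂)
open import Data.Sum using (inj₁; inj₂)
open import Data.List using (List; []; _∷_; map; foldr; cartesianProduct; allFin)
open import Data.List.Relation.Unary.Any using (here; there)
open import Data.List.Relation.Unary.All using ([]; _∷_)
open import Data.List.Relation.Unary.AllPairs using ([]; _∷_)
open import Data.List.Membership.Propositional using (_∈_)
open import Data.List.Relation.Unary.Unique.Propositional using (Unique)
open import Data.List.Membership.Propositional.Properties
  using (∈-filter⁺; ∈-filter⁻; ∈-cartesianProduct⁺; ∈-allFin)
open import Data.Empty using (⊥; ⊥-elim)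
open import Relation.Nullary using (¬_; Dec; yes; no)
open import Relation.Binary using (tri<; tri≈; tri>)
open import Relation.Binary.PropositionalEquality using (_≡_; _≢_; refl; sym; trans; cong)

module _ {A : Set} (f : A → Bool) where

  product : List A → Bool
  product = foldr (λ p acc → f p ∧ acc) true

  product-zero⁺ : ∀ {p} xs → p ∈ xs → f p ≡ false → product xs ≡ false
  product-zero⁺ (q ∷ xs) (here refl) fp≡0 rewrite fp≡0 = refl
  product-zero⁺ (q ∷ xs) (there p∈xs) fp≡0 with f q
  ... | true  = product-zero⁺ xs p∈xs fp≡0
  ... | false = refl

  product-zero⁻ : ∀ xs → product xs ≡ false → ∃[ p ] (p ∈ xs × f p ≡ false)
  product-zero⁻ (q ∷ xs) prod≡0 with f q in fq
  ... | true  = let (p , p∈xs , fp≡0) = product-zero⁻ xs prod≡0 in p , there p∈xs , fp≡0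
  ... | false = q , here refl , fq

distinct⇒sum+1≡0 : ∀ {x y} → x ≢ y → (x xor y) xor true ≡ false
distinct⇒sum+1≡0 {true}  {true}  x≢y = ⊥-elim (x≢y refl)
distinct⇒sum+1≡0 {true}  {false} _   = refl
distinct⇒sum+1≡0 {false} {true}  _   = refl
distinct⇒sum+1≡0 {false} {false} x≢y = ⊥-elim (x≢y refl)

sum+1≡0⇒distinct : ∀ x y → (x xor y) xor true ≡ false → x ≢ y
sum+1≡0⇒distinct true  true  () _
sum+1≡0⇒distinct false false () _
sum+1≡0⇒distinct true  false _  ()
sum+1≡0⇒distinct false true  _  ()

-- Colours Fin k and F₂: for k ≤ 2 the map Fin k → Bool below is injective,
-- so a colouring with at most two colours is read as a point of F₂^m.
finToBool : ∀ {k} → Fin k → Bool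
finToBool zero    = true
finToBool (suc _) = false

finToBool-injective : ∀ {k} → k ≤ℕ 2 → {p q : Fin k} → p ≢ q → finToBool p ≢ finToBool q
finToBool-injective _                  {zero}      {zero}      p≢q _ = p≢q refl
finToBool-injective (s≤s (s≤s z≤n))    {suc zero}  {suc zero}  p≢q _ = p≢q refl
finToBool-injective _                  {zero}      {suc _}     _   ()
finToBool-injective _                  {suc _}     {zero}      _   ()

boolToFin : Bool → Fin 2
boolToFin true  = zero
boolToFin false = suc zero

boolToFin-injective : ∀ {x y} → x ≢ y → boolToFin x ≢ boolToFin y
boolToFin-injective {true}  {true}  x≢y _ = x≢y refl
boolToFin-injective {false} {false} x≢y _ = x≢y refl
boolToFin-injective {true}  {false} _   ()
boolToFin-injective {false} {true}  _   ()

-- Pigeonhole for at most two colours: there are no three pairwise distinct ones.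
-- This is why rainbow paths under a 2-colouring have at most two edges.
no-three-distinct : ∀ {k} → k ≤ℕ 2 → (p q r : Fin k) → p ≢ q → p ≢ r → q ≢ r → ⊥
no-three-distinct _               zero       zero       _          p≢q _   _   = p≢q refl
no-three-distinct _               zero       (suc _)    zero       _   p≢r _   = p≢r refl
no-three-distinct (s≤s (s≤s z≤n)) zero       (suc zero) (suc zero) _   _   q≢r = q≢r refl
no-three-distinct _               (suc _)    zero       zero       _   _   q≢r = q≢r refl
no-three-distinct (s≤s (s≤s z≤n)) (suc zero) zero       (suc zero) _   p≢r _   = p≢r refl
no-three-distinct (s≤s (s≤s z≤n)) (suc zero) (suc zero) _          p≢q _   _   = p≢q refl

module _ (G : SimpleGraph) where
  open SimpleGraph G

  joins-sym : ∀ {a u w} → Joins G a u w → Joins G a w u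
  joins-sym (inj₁ e) = inj₂ e
  joins-sym (inj₂ e) = inj₁ e

  joins-distinct : ∀ {a u w} → Joins G a u w → u ≢ w
  joins-distinct {a} (inj₁ e) refl = noLoop a (trans (cong proj₁ e) (sym (cong proj₂ e)))
  joins-distinct {a} (inj₂ e) refl = noLoop a (trans (cong proj₁ e) (sym (cong proj₂ e)))

  adjacent? : ∀ u v → Dec (Adjacent G u v)
  adjacent? u v = any? (λ a → joins? G a u v)

  RainbowPath : {C : Set} → (Fin m → C) → Fin n → Fin n → Set
  RainbowPath c u v = ∃[ vs ] ∃[ es ] (Path G u v vs es × Unique (map c es))

  RainbowTwoPath : {C : Set} → (Fin m → C) → Fin n → Fin n → Set
  RainbowTwoPath c u v = ∃[ a ] ∃[ b ] ∃[ w ] (Joins G a u w × Joins G b w v × c a ≢ c b)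

  rainbowTwoPath-sym : ∀ {C} {c : Fin m → C} {u v} → RainbowTwoPath c u v → RainbowTwoPath c v u
  rainbowTwoPath-sym (a , b , w , ja , jb , ca≢cb) =
    b , a , w , joins-sym jb , joins-sym ja , λ e → ca≢cb (sym e)

  trivial-rainbow : ∀ {C} (c : Fin m → C) u → RainbowPath c u u
  trivial-rainbow c u = u ∷ [] , [] , (here , [] ∷ []) , []

  edge-rainbow : ∀ {C} (c : Fin m → C) {u v a} → Joins G a u v → RainbowPath c u v
  edge-rainbow c {u} {v} {a} ja =
    u ∷ v ∷ [] , a ∷ [] , (step a ja here , (joins-distinct ja ∷ []) ∷ [] ∷ []) , [] ∷ []

  twoPath-rainbow : ∀ {C} (c : Fin m → C) {u v} → u ≢ v → RainbowTwoPath c u v → RainbowPath c u v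
  twoPath-rainbow c {u} {v} u≢v (a , b , w , ja , jb , ca≢cb) =
    u ∷ w ∷ v ∷ [] , a ∷ b ∷ [] ,
    (step a ja (step b jb here) ,
     (joins-distinct ja ∷ u≢v ∷ []) ∷ (joins-distinct jb ∷ []) ∷ [] ∷ []) ,
    (ca≢cb ∷ []) ∷ [] ∷ []

  -- With at most two colours, a rainbow path between distinct non-adjacent
  -- vertices is a rainbow 2-path: it cannot have 0 or 1 edges, nor 3 or more.
  rainbow⇒rainbowTwoPath : ∀ {k} → k ≤ℕ 2 → (c : Fin m → Fin k) → ∀ {u v} →
    u ≢ v → ¬ Adjacent G u v → RainbowPath c u v → RainbowTwoPath c u v
  rainbow⇒rainbowTwoPath _ c u≢v _ (_ , [] , (here , _) , _) = ⊥-elim (u≢v refl)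
  rainbow⇒rainbowTwoPath _ c _ ¬adj (_ , a ∷ [] , (step .a ja here , _) , _) = ⊥-elim (¬adj (a , ja))
  rainbow⇒rainbowTwoPath _ c _ _
    (_ , a ∷ b ∷ [] , (step .a ja (step .b jb here) , _) , (ca≢cb ∷ []) ∷ _) =
    a , b , _ , ja , jb , ca≢cb
  rainbow⇒rainbowTwoPath k≤2 c _ _
    (_ , a ∷ b ∷ d ∷ _ , _ , (ca≢cb ∷ ca≢cd ∷ _) ∷ (cb≢cd ∷ _) ∷ _) =
    ⊥-elim (no-three-distinct k≤2 (c a) (c b) (c d) ca≢cb ca≢cd cb≢cd)

  rainbowTwoPath⇒equation : ∀ (x : Fin m → Bool) {i j} → RainbowTwoPath x i j → evalS G x i j ≡ false
  rainbowTwoPath⇒equation x {i} {j} (a , b , w , ja , jb , xa≢xb) =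
    product-zero⁺ (λ p → (x (proj₁ p) xor x (proj₂ p)) xor true) (twoPaths G i j)
      (∈-filter⁺ (twoPath? G i j) (∈-cartesianProduct⁺ (∈-allFin a) (∈-allFin b)) (w , ja , jb))
      (distinct⇒sum+1≡0 xa≢xb)

  equation⇒rainbowTwoPath : ∀ (x : Fin m → Bool) {i j} → evalS G x i j ≡ false → RainbowTwoPath x i j
  equation⇒rainbowTwoPath x {i} {j} eq≡0
    with product-zero⁻ (λ p → (x (proj₁ p) xor x (proj₂ p)) xor true) (twoPaths G i j) eq≡0
  ... | (a , b) , ab∈twoPaths , factor≡0
    with ∈-filter⁻ (twoPath? G i j) {xs = cartesianProduct (allFin m) (allFin m)} ab∈twoPaths
  ... | _ , (w , ja , jb) = a , b , w , ja , jb , sum+1≡0⇒distinct (x a) (x b) factor≡0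

  recolour : ∀ {C D} {c : Fin m → C} (f : C → D) → (∀ {p q} → p ≢ q → f p ≢ f q) →
    ∀ {u v} → RainbowTwoPath c u v → RainbowTwoPath (λ a → f (c a)) u v
  recolour f f-inj (a , b , w , ja , jb , ca≢cb) = a , b , w , ja , jb , f-inj ca≢cb

  rainbow⇒solution : RcAtMost2 G → SHasSolution G
  rainbow⇒solution (k , k≤2 , c , rc) = x , solves
    where
    x : Fin m → Bool
    x a = finToBool (c a)

    solves : SolvesS G x
    solves i j i<j ¬adj =
      rainbowTwoPath⇒equation x
        (recolour finToBool (finToBool-injective k≤2)
          (rainbow⇒rainbowTwoPath k≤2 c (<⇒≢ i<j) ¬adj (rc i j)))

  solution⇒rainbow : SHasSolution G → RcAtMost2 G
  solution⇒rainbow (x , solves) = 2 , s≤s (s≤s z≤n) , c , connected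
    where
    c : Fin m → Fin 2
    c a = boolToFin (x a)

    nonadjacent : ∀ {i j} → i < j → ¬ Adjacent G i j → RainbowTwoPath c i j
    nonadjacent i<j ¬adj =
      recolour boolToFin boolToFin-injective
        (equation⇒rainbowTwoPath x (solves _ _ i<j ¬adj))

    connected : RainbowConnected G 2 c
    connected u v with adjacent? u v | <-cmp u v
    ... | yes (_ , ja) | _             = edge-rainbow c ja
    ... | no _         | tri≈ _ refl _ = trivial-rainbow c u
    ... | no ¬adj      | tri< u<v _ _  = twoPath-rainbow c (<⇒≢ u<v) (nonadjacent u<v ¬adj)
    ... | no ¬adj      | tri> _ _ v<u  =
      twoPath-rainbow c (λ u≡v → <⇒≢ v<u (sym u≡v))
        (rainbowTwoPath-sym (nonadjacent v<u (λ (a , ja) → ¬adj (a , joins-sym ja))))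

mainTheorem2 : (G : SimpleGraph) → DiameterAtMost2 G → (RcAtMost2 G ⇔ SHasSolution G)
mainTheorem2 G _ = mk⇔ (rainbow⇒solution G) (solution⇒rainbow G)
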